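{- For every essential $S$-tree $(T,\alpha)$ over stars, the map $\alpha:\vec E(T)\to\vec S$ is injective.
   Context: A separation system $(\vec S,\le,{}^*)$ is a poset with an order-reversing involution; write $\overleftarrow s=\vec s^{\,*}$. $\vec r$ is trivial (in $\vec S$) if there is a separation $\{\vec s,\overleftarrow s\}$ with $\vec r<\vec s$ and $\vec r<\overleftarrow s$. A star is a set $\sigma$ of nondegenerate ($\vec s\ne\overleftarrow s$) elements with $\vec r\le\overleftarrow s$ for all distinct $\vec r,\vec s\in\sigma$. For a tree $T$, $\vec E(T)=\{(x,y):xy\in E(T)\}$, $\vec F_t=\{(x,t):xt\in E(T)\}$. An $S$-tree is a pair $(T,\alpha)$ with $\alpha:\vec E(T)\to\vec S$, $\alpha(y,x)=\alpha(x,y)^*$; it is over stars if every $\alpha(\vec F_t)$ belongs to a fixed set of stars (so is a star); irredundant if no node $t$ has distinct neighbours $t',t''$ with $\alpha(t,t')=\alpha(t,t'')$; tight if no $\alpha(\vec F_t)$ contains both $\vec s$ and $\overleftarrow s$ with $\vec s\ne\overleftarrow s$; essential if irredundant, tight, and $\alpha(\vec E(T))$ contains no trivial element of $\vec S$. -}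

module Defs where

open import Level using (Level; _⊔_; suc)
open import Data.Nat using (ℕ; _≤_)
open import Data.Fin using (Fin)
open import Data.List using (List; []; _∷_; _++_; [_]; length)
open import Data.List.Relation.Unary.Linked using (Linked)
open import Data.List.Relation.Unary.Unique.Propositional using (Unique)
open import Data.Product using (_×_; Σ; ∃; ∃-syntax)
open import Relation.Nullary using (¬_)
open import Relation.Binary.PropositionalEquality using (_≡_)
open import Relation.Binary.Structures using (IsPartialOrder)
open import Relation.Binary.Construct.Closure.ReflexiveTransitive using (Star)

record SeparationSystem (a ℓ : Level) : Set (Level.suc (a ⊔ ℓ)) where
  infix 4 _≤ₛ_ _<ₛ_
  infix 10 _*
  field
    Carrier        : Set a
    _≤ₛ_           : Carrier → Carrier → Set ℓ
    isPartialOrder : IsPartialOrder _≡_ _≤ₛ_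
    _*             : Carrier → Carrier
    involutive     : ∀ s → (s *) * ≡ s
    order-reversing : ∀ {r s} → r ≤ₛ s → s * ≤ₛ r *

  _<ₛ_ : Carrier → Carrier → Set (a ⊔ ℓ)
  r <ₛ s = (r ≤ₛ s) × ¬ (r ≡ s)

  Trivial : Carrier → Set (a ⊔ ℓ)
  Trivial r = ∃[ s ] ((r <ₛ s) × (r <ₛ (s *)))

  Nondegenerate : Carrier → Set a
  Nondegenerate s = ¬ (s ≡ s *)

record Tree : Set₁ where
  field
    n         : ℕ
    Adj       : Fin n → Fin n → Set
    sym       : ∀ {x y} → Adj x y → Adj y x
    irrefl    : ∀ {x} → ¬ Adj x x
    connected : ∀ x y → Star Adj x y
    acyclic   : ∀ (x : Fin n) (xs : List (Fin n)) →
                2 ≤ length xs → Unique (x ∷ xs) →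
                ¬ Linked Adj (x ∷ xs ++ [ x ])

-- S-trees.  The orientation map α is given on all ordered pairs of
-- vertices, but only its values on oriented edges (x , y) with Adj x y
-- are ever used.

module _ {a ℓ : Level} (𝕊 : SeparationSystem a ℓ) (T : Tree) where
  open SeparationSystem 𝕊
  open Tree T

  record STree : Set (a ⊔ ℓ) where
    field
      α     : Fin n → Fin n → Carrier
      α-inv : ∀ {x y} → Adj x y → α y x ≡ (α x y) *

  module _ (τ : STree) where
    open STree τ

    OverStars : Set (a ⊔ ℓ)
    OverStars = ∀ t x y → Adj x t → Adj y t →
                Nondegenerate (α x t) ×
                (¬ (α x t ≡ α y t) → α x t ≤ₛ (α y t) *)

    Irredundant : Set a
    Irredundant = ∀ t t' t'' → Adj t t' → Adj t t'' →
                  ¬ (t' ≡ t'') → ¬ (α t t' ≡ α t t'')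

    Tight : Set a
    Tight = ∀ t x y → Adj x t → Adj y t →
            ¬ ((α y t ≡ (α x t) *) × ¬ (α x t ≡ (α x t) *))

    NoTrivial : Set (a ⊔ ℓ)
    NoTrivial = ∀ x y → Adj x y → ¬ Trivial (α x y)

    Essential : Set (a ⊔ ℓ)
    Essential = Irredundant × Tight × NoTrivial

    InjectiveOnEdges : Set a
    InjectiveOnEdges = ∀ x y x' y' → Adj x y → Adj x' y' →
                       α x y ≡ α x' y' → (x ≡ x') × (y ≡ y')

module Submission where

-- The argument rests on one local fact: if x – y – z is a path with x ≠ z, then
-- α(x,y) < α(y,z).  Indeed α(x,y) and α(z,y) are distinct (irredundancy) members
-- of the star α(F_y), so α(x,y) ≤ α(z,y)* = α(y,z), and equality is excluded by
-- tightness.  Consequently α strictly increases along every non-backtracking walk.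
--
-- For oriented edges (x,y), (x',y') with equal
-- images, we reduce a walk from x to x' and compare its end edges with (x,y) and
-- (x',y'): either the two edges extend it to a non-backtracking walk along which α
-- would strictly increase, or some α(e) lies strictly between a separation r and
-- its inverse r*, making r trivial, or the configuration is so small that it
-- contradicts irredundancy or nondegeneracy directly.

open import Level using (Level; _⊔_)
open import Defs
open import Data.Fin using (_≟_)
open import Data.Product using (_×_; _,_; proj₁; proj₂; ∃₂)
open import Data.Sum using (_⊎_; inj₁; inj₂)
open import Data.Empty using (⊥; ⊥-elim)
open import Relation.Nullary using (¬_; yes; no)
open import Relation.Binary.Definitions using (DecidableEquality)
open import Relation.Binary.PropositionalEquality
  using (_≡_; refl; sym; trans; cong; subst)
open import Relation.Binary.Structures using (IsPartialOrder)
open import Relation.Binary.Construct.Closure.ReflexiveTransitive using (Star; ε; _◅_)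

module SeparationOrder {a ℓ : Level} (𝕊 : SeparationSystem a ℓ) where
  open SeparationSystem 𝕊
  private module PO = IsPartialOrder isPartialOrder

  <-trans : ∀ {r s t} → r <ₛ s → s <ₛ t → r <ₛ t
  <-trans (r≤s , r≢s) (s≤t , _) =
    PO.trans r≤s s≤t ,
    λ { refl → r≢s (PO.antisym r≤s s≤t) }

  <-flip : ∀ {r s} → s <ₛ r * → r <ₛ s *
  <-flip {r} {s} (s≤r* , s≢r*) =
    subst (_≤ₛ s *) (involutive r) (order-reversing s≤r*) ,
    λ r≡s* → s≢r* (trans (sym (involutive s)) (cong _* (sym r≡s*)))

  trivial-below : ∀ {r s} → r <ₛ s → s <ₛ r * → Trivial r
  trivial-below {s = s} r<s s<r* = s , r<s , <-flip s<r*

module NonBacktracking {v e : Level} {V : Set v} (_≟ᵥ_ : DecidableEquality V)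
                       (Adj : V → V → Set e) where

  -- Walk a b c d: a non-backtracking walk (at least one edge) whose first
  -- oriented edge is (a,b) and whose last oriented edge is (c,d).
  data Walk : V → V → V → V → Set (v ⊔ e) where
    edge : ∀ {a b} → Adj a b → Walk a b a b
    step : ∀ {a b c d f} → Walk a b c d → Adj d f → ¬ c ≡ f → Walk a b d f

  cons : ∀ {a b f c d} → Adj a b → ¬ a ≡ f → Walk b f c d → Walk a b c d
  cons ab a≢f (edge bf)       = step (edge ab) bf a≢f
  cons ab a≢f (step w df c≢g) = step (cons ab a≢f w) df c≢g

  Connection : V → V → Set (v ⊔ e)
  Connection x x' = (x ≡ x') ⊎ ∃₂ λ b c → Walk x b c x'

  firstEdge : ∀ {a b c d} → Walk a b c d → Adj a b
  firstEdge (edge ab)    = ab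
  firstEdge (step w _ _) = firstEdge w

  dropLast : ∀ {a b c d} → Walk a b c d → Connection a c
  dropLast (edge _)     = inj₁ refl
  dropLast (step w _ _) = inj₂ (_ , _ , w)

  extend : ∀ {x c d} → Connection x c → Adj c d → Connection x d
  extend (inj₁ refl) cd = inj₂ (_ , _ , edge cd)
  extend {d = d} (inj₂ (_ , w , walk)) cd with w ≟ᵥ d
  ... | yes refl = dropLast walk
  ... | no w≢d   = inj₂ (_ , _ , step walk cd w≢d)

  connection : ∀ {x c x'} → Connection x c → Star Adj c x' → Connection x x'
  connection conn ε          = conn
  connection conn (cd ◅ path) = connection (extend conn cd) path

module Injectivity {a ℓ : Level} (𝕊 : SeparationSystem a ℓ) (T : Tree)
  (τ : STree 𝕊 T) (overStars : OverStars 𝕊 T τ) (irredundant : Irredundant 𝕊 T τ)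
  (tight : Tight 𝕊 T τ) (noTrivial : NoTrivial 𝕊 T τ) where
  open SeparationSystem 𝕊
  open SeparationOrder 𝕊
  open Tree T renaming (sym to adj-sym)
  open STree τ
  open NonBacktracking _≟_ Adj

  α-inv* : ∀ {x y} → Adj x y → (α y x) * ≡ α x y
  α-inv* {x} {y} xy = trans (cong _* (α-inv xy)) (involutive (α x y))

  α-reverse : ∀ {x y x' y'} → Adj x y → Adj x' y' →
              α x y ≡ α x' y' → α y x ≡ α y' x'
  α-reverse xy x'y' eq = trans (α-inv xy) (trans (cong _* eq) (sym (α-inv x'y')))

  turn-increases : ∀ {x y z} → Adj x y → Adj y z → ¬ x ≡ z → α x y <ₛ α y z
  turn-increases {x} {y} {z} xy yz x≢z = below , distinct
    where
    star-at-y : Nondegenerate (α x y) × (¬ α x y ≡ α z y → α x y ≤ₛ (α z y) *)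
    star-at-y = overStars y x z xy (adj-sym yz)
    different : ¬ α x y ≡ α z y
    different eq = irredundant y x z (adj-sym xy) yz x≢z
      (trans (α-inv xy) (trans (cong _* eq) (α-inv* yz)))
    below : α x y ≤ₛ α y z
    below = subst (α x y ≤ₛ_) (α-inv* yz) (proj₂ star-at-y different)
    distinct : ¬ α x y ≡ α y z
    distinct eq = tight y x z xy (adj-sym yz)
      (trans (α-inv yz) (cong _* (sym eq)) , proj₁ star-at-y)

  increases : ∀ {a b c d f} → Walk a b c d → Adj d f → ¬ c ≡ f → α a b <ₛ α d f
  increases (edge ab)       bf a≢f = turn-increases ab bf a≢f
  increases (step w cd b≢d) df c≢f =
    <-trans (increases w cd b≢d) (turn-increases cd df c≢f)

  increases-cons : ∀ {a b f c d} → Adj a b → ¬ a ≡ f → Walk b f c d → α a b <ₛ α c d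
  increases-cons ab a≢f (edge bf)       = turn-increases ab bf a≢f
  increases-cons ab a≢f (step w df c≢g) = increases (cons ab a≢f w) df c≢g

  reversed-ends : ∀ {x y y' x'} → Adj x y → Adj x' y' →
                  α x y ≡ α x' y' → Walk x y y' x' → ⊥
  reversed-ends xy _ eq (edge _) =
    proj₁ (overStars _ _ _ xy xy) (trans eq (α-inv xy))
  reversed-ends xy x'y' eq (step (edge _) _ x≢x') =
    irredundant _ _ _ (adj-sym xy) (adj-sym x'y') x≢x' (α-reverse xy x'y' eq)
  reversed-ends xy x'y' eq (step (step w cy' b≢y') y'x' c≢x') =
    noTrivial _ _ xy
      (trivial-below (increases w cy' b≢y')
        (subst (_ <ₛ_) (trans (α-inv x'y') (cong _* (sym eq)))
          (turn-increases cy' y'x' c≢x')))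

  -- Oriented edges (x,y), (x',y') with equal images admit no non-backtracking walk
  -- from x to x'; the cases are how (x,y) and (x',y') meet its first and last edge.
  ends-of-walk : ∀ {x y x' y' b c} → Adj x y → Adj x' y' →
                 α x y ≡ α x' y' → Walk x b c x' → ⊥
  ends-of-walk {y = y} {y' = y'} {b} {c} xy x'y' eq walk
    with y ≟ b | c ≟ y'
  ... | yes refl | no c≢y' = proj₂ (increases walk x'y' c≢y') eq
  ... | no y≢b   | yes refl =
        proj₂ (increases-cons (adj-sym xy) y≢b walk) (α-reverse xy x'y' eq)
  ... | no y≢b   | no c≢y' = noTrivial _ _ (adj-sym xy)
        (trivial-below (turn-increases (adj-sym xy) (firstEdge walk) y≢b)
          (subst (_ <ₛ_) (trans (sym eq) (sym (α-inv* xy)))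
            (increases walk x'y' c≢y')))
  ... | yes refl | yes refl = reversed-ends xy x'y' eq walk

  injective : InjectiveOnEdges 𝕊 T τ
  injective x y x' y' xy x'y' eq
    with connection (inj₁ refl) (connected x x')
  ... | inj₂ (_ , _ , walk) = ⊥-elim (ends-of-walk xy x'y' eq walk)
  ... | inj₁ refl with y ≟ y'
  ...   | yes refl = refl , refl
  ...   | no y≢y'  = ⊥-elim (irredundant _ y y' xy x'y' y≢y' eq)

lemma6p8 : ∀ {a ℓ : Level} (𝕊 : SeparationSystem a ℓ) (T : Tree)
           (τ : STree 𝕊 T) →
           OverStars 𝕊 T τ → Essential 𝕊 T τ → InjectiveOnEdges 𝕊 T τ
lemma6p8 𝕊 T τ overStars (irredundant , tight , noTrivial) =
  Injectivity.injective 𝕊 T τ overStars irredundant tight noTrivial
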